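{- Let $n\ge k\ge 0$ with $n-k$ even, and $m\in\mathcal{M}_{n,k}$. Then (a) $\mathrm{cMDes}(m)=\varnothing$ if and only if $k=n$; and (b) $\mathrm{cMDes}(m)=[n]$ if and only if $k=0$ and $\mathrm{crn}(m)=n/2$, i.e., $n$ is even and $m$ matches $i$ with $i+n/2$ for every $1\le i\le n/2$.
   Context: $\mathcal{M}_{n,k}$: partial matchings on $[n]$ with exactly $k$ unmatched points. Place $1,\dots,n$ on a circle, matched pairs drawn as chords. With indices mod $n$ ($n+1\equiv 1$), $i\in[n]$ belongs to $\mathrm{cMDes}(m)$ if (1) $\{i,i+1\}$ is a chord; or (2) $i,i+1$ lie on two distinct chords which intersect (endpoints interleave around the circle); or (3) $i$ is unmatched and $i+1$ is matched. $\mathrm{crn}(m)$: maximal $r$ with pairs $\{i_1,j_1\},\dots,\{i_r,j_r\}$, $i_1<\dots<i_r<j_1<\dots<j_r$. -}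

module Defs where

open import Data.Nat using (ℕ; zero; suc; _+_; _<_; _≤_; _⊓_; _⊔_; _<?_)
open import Data.Fin using (Fin; toℕ; fromℕ<) renaming (zero to fzero)
open import Data.Maybe using (Maybe; just; nothing; is-nothing)
open import Data.Bool using (if_then_else_)
open import Data.List using (map; allFin)
open import Data.Nat.ListAction using (sum)
open import Data.Product using (Σ; _×_; ∃-syntax)
open import Data.Sum using (_⊎_)
open import Relation.Binary.PropositionalEquality using (_≡_; _≢_)
open import Relation.Nullary using (yes; no; ¬_)

-- Points 1..n of the paper are represented by Fin n (0-based: point i+1 ↦ i).
-- A partial matching is a partner function: m i ≡ just j  iff  {i,j} is a chord.
record IsPartialMatching {n : ℕ} (m : Fin n → Maybe (Fin n)) : Set where
  field
    symmetric   : ∀ i j → m i ≡ just j → m j ≡ just i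
    irreflexive : ∀ i → m i ≢ just i

unmatched : {n : ℕ} → (Fin n → Maybe (Fin n)) → ℕ
unmatched {n} m = sum (map (λ i → if is-nothing (m i) then 1 else 0) (allFin n))

record Matching (n k : ℕ) : Set where
  field
    partner   : Fin n → Maybe (Fin n)
    isMatching : IsPartialMatching partner
    numUnmatched : unmatched partner ≡ k
open Matching public

nxt : {n : ℕ} → Fin n → Fin n
nxt {suc n} i with suc (toℕ i) <? suc n
... | yes p = fromℕ< p
... | no _  = fzero

-- chords {a,b} and {c,d} intersect: endpoints interleave around the circle
Cross : ℕ → ℕ → ℕ → ℕ → Set
Cross a b c d =
  ((a ⊓ b) < (c ⊓ d) × (c ⊓ d) < (a ⊔ b) × (a ⊔ b) < (c ⊔ d))
  ⊎ ((c ⊓ d) < (a ⊓ b) × (a ⊓ b) < (c ⊔ d) × (c ⊔ d) < (a ⊔ b))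

data InCMDes {n : ℕ} (m : Fin n → Maybe (Fin n)) (i : Fin n) : Set where
  chord    : m i ≡ just (nxt i) → InCMDes m i
  crossing : (j j' : Fin n) → m i ≡ just j → m (nxt i) ≡ just j'
           → j ≢ nxt i
           → Cross (toℕ i) (toℕ j) (toℕ (nxt i)) (toℕ j') → InCMDes m i
  unmatchedThenMatched : m i ≡ nothing → (j : Fin n) → m (nxt i) ≡ just j → InCMDes m i

HasCrossing : {n : ℕ} → (Fin n → Maybe (Fin n)) → ℕ → Set
HasCrossing {n} m r =
  Σ (Fin r → Fin n) λ is → Σ (Fin r → Fin n) λ js →
    (∀ t → m (is t) ≡ just (js t))
    × (∀ s t → toℕ s < toℕ t → toℕ (is s) < toℕ (is t))
    × (∀ s t → toℕ s < toℕ t → toℕ (js s) < toℕ (js t))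
    × (∀ s t → toℕ (is s) < toℕ (js t))

IsCrn : {n : ℕ} → (Fin n → Maybe (Fin n)) → ℕ → Set
IsCrn m r = HasCrossing m r × (∀ r' → HasCrossing m r' → r' ≤ r)

-- (a) Without descents, being unmatched propagates from i to i+1 round the circle, so either
-- every point is unmatched or every point is matched. In the second case a chord {a, b}
-- with a < b forces the partner c of a+1 into the open interval (a+1, b): otherwise {a, b}
-- and {a+1, c} would cross, or {a, a+1} would be a chord. The chord {a+1, c} is shorter,
-- so this descends forever.
--
-- (b) If every point is a descent, every point is matched, and the clockwise length of the
-- chord at i can only grow from i to i+1: a descent at i says precisely that the chord at
-- i+1 ends clockwise beyond the chord at i. Going once round the circle this length is
-- constant, say h; the chord at 0 then gives n = 2h, and i is matched with i + h. Conversely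
-- the antipodal matching has constant chord length, hence all descents. A crossing of size
-- r uses 2r points in strictly increasing order, so crn ≤ n/2, and a crossing of size n/2
-- must place its left ends at 0, …, h−1 and its right ends at h, …, 2h−1.
module Submission where

open import Data.Bool using (if_then_else_)
open import Data.Empty using (⊥; ⊥-elim)
open import Data.Fin using (Fin; toℕ; fromℕ; fromℕ<; inject₁) renaming (zero to fzero; suc to fsuc)
import Data.Fin as Fin using (_<_)
open import Data.Fin.Induction using (<-weakInduction; <-weakInduction-startingFrom; <-wellFounded)
open import Data.Fin.Properties
  using (_≟_; toℕ-injective; toℕ<n; toℕ-fromℕ<; toℕ-fromℕ; toℕ-inject₁; ≤fromℕ)
import Data.Fin.Properties as Fin using (<-cmp)
open import Data.List using ([]; _∷_; map; length; allFin)
open import Data.List.Membership.Propositional.Properties using (∈-allFin)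
open import Data.List.Properties using (length-tabulate)
open import Data.List.Relation.Unary.All as All using (All; []; _∷_)
open import Data.Maybe using (Maybe; just; nothing; maybe′; is-nothing)
open import Data.Maybe.Properties using (just-injective)
open import Data.Nat
  using (ℕ; zero; suc; _≤_; _<_; _∸_; _+_; _*_; ⌊_/2⌋; _⊓_; _⊔_; _<?_; z≤n; s≤s; s<s)
open import Data.Nat.Divisibility using (_∣_; divides)
open import Data.Nat.ListAction using (sum)
open import Data.Nat.Properties hiding (_≟_)
open import Algebra.Properties.CommutativeSemigroup +-commutativeSemigroup using (x∙yz≈y∙xz)
open import Data.Product using (_×_; _,_; ∃; proj₁; proj₂; uncurry; map₁)
open import Data.Sum using (_⊎_; inj₁; inj₂; swap)
open import Function using (id; _∘_)
open import Function.Bundles using (_⇔_; mk⇔; Equivalence)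
open import Function.Properties.Equivalence using () renaming (trans to ⇔-trans; sym to ⇔-sym)
open import Induction.WellFounded using (Acc; acc)
open import Relation.Binary.Definitions using (Tri; tri<; tri≈; tri>)
open import Relation.Binary.PropositionalEquality
open import Relation.Nullary using (¬_; yes; no; contradiction)

open import Defs

PartnerMap : ℕ → Set
PartnerMap n = Fin n → Maybe (Fin n)

-- Crossing chords

Interleaved : ℕ → ℕ → ℕ → ℕ → Set
Interleaved a b c d = (a < c × c < b × b < d) ⊎ (c < a × a < d × d < b)

Cross≡Interleaved : ∀ {a b c d} → a ≤ b → c ≤ d → Cross a b c d ≡ Interleaved a b c d
Cross≡Interleaved {a} {b} {c} {d} a≤b c≤d =
  trans (cong₂ (λ l u → Interleaved l u (c ⊓ d) (c ⊔ d)) (m≤n⇒m⊓n≡m a≤b) (m≤n⇒m⊔n≡n a≤b))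
        (cong₂ (Interleaved a b) (m≤n⇒m⊓n≡m c≤d) (m≤n⇒m⊔n≡n c≤d))

Cross-intro : ∀ {a b c d} → a < c → c < b → b < d → Cross a b c d
Cross-intro a<c c<b b<d =
  subst id (sym (Cross≡Interleaved (<⇒≤ (<-trans a<c c<b)) (<⇒≤ (<-trans c<b b<d))))
           (inj₁ (a<c , c<b , b<d))

Cross-elim : ∀ {a b c d} → a ≤ b → c ≤ d → Cross a b c d → Interleaved a b c d
Cross-elim a≤b c≤d = subst id (Cross≡Interleaved a≤b c≤d)

Cross-sym : ∀ {a b c d} → Cross a b c d → Cross c d a b
Cross-sym = swap

Cross-swapˡ : ∀ {a b c d} → Cross a b c d → Cross b a c d
Cross-swapˡ {a} {b} {c} {d} = subst₂ (λ l u → Interleaved l u (c ⊓ d) (c ⊔ d)) (⊓-comm a b) (⊔-comm a b)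

Cross-swapʳ : ∀ {a b c d} → Cross a b c d → Cross a b d c
Cross-swapʳ = Cross-sym ∘ Cross-swapˡ ∘ Cross-sym

-- Clockwise distance on the n-cycle

CyclicSucc : ℕ → ℕ → ℕ → Set
CyclicSucc n x y = (suc x < n × y ≡ suc x) ⊎ (suc x ≡ n × y ≡ 0)

opaque
  -- the clockwise distance from x to a, which is n (not 0) when a ≡ x;
  -- it is used only through dist-< and dist-≥
  dist : ℕ → ℕ → ℕ → ℕ
  dist n x a with x <? a
  ... | yes _ = a ∸ x
  ... | no _  = a + n ∸ x

  dist-< : ∀ {n x a} → x < a → dist n x a + x ≡ a
  dist-< {x = x} {a} x<a with x <? a
  ... | yes _   = m∸n+n≡m (<⇒≤ x<a)
  ... | no x≮a = contradiction x<a x≮a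

  dist-≥ : ∀ {n x a} → a ≤ x → x ≤ n → dist n x a + x ≡ a + n
  dist-≥ {n} {x} {a} a≤x x≤n with x <? a
  ... | yes x<a = contradiction a≤x (<⇒≱ x<a)
  ... | no _    = m∸n+n≡m (≤-trans x≤n (m≤n+m n a))

dist-<-suc : ∀ {n x a} → x < a → dist n x a + suc x ≡ suc a
dist-<-suc {x = x} x<a = trans (+-suc _ x) (cong suc (dist-< x<a))

dist-≥-suc : ∀ {n x a} → a ≤ x → x < n → dist n x a + suc x ≡ suc a + n
dist-≥-suc {x = x} a≤x x<n = trans (+-suc _ x) (cong suc (dist-≥ a≤x (<⇒≤ x<n)))

dist-pos : ∀ {n x} a → x < n → 0 < dist n x a
dist-pos {n} {x} a x<n = +-cancelʳ-< x 0 _ x<dist+x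
  where
  x<dist+x : x < dist n x a + x
  x<dist+x with <-≤-connex x a
  ... | inj₁ x<a = subst (x <_) (sym (dist-< x<a)) x<a
  ... | inj₂ a≤x = subst (x <_) (sym (dist-≥ a≤x (<⇒≤ x<n))) (<-≤-trans x<n (m≤n+m n a))

dist-successor : ∀ {n x y} → CyclicSucc n x y → dist n x y ≡ 1
dist-successor {x = x} (inj₁ (_ , refl)) = +-cancelʳ-≡ x _ 1 (dist-< ≤-refl)
dist-successor {x = x} (inj₂ (refl , refl)) = +-cancelʳ-≡ x _ 1 (dist-≥ z≤n (n≤1+n x))

dist-+ : ∀ {n x d} → 0 < d → dist n x (x + d) ≡ d
dist-+ {x = x} {d} 0<d = +-cancelˡ-≡ x _ d (trans (+-comm x _) (dist-< (m<m+n x 0<d)))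

dist-back : ∀ {n a d} → a + d ≤ n → dist n (a + d) a ≡ n ∸ d
dist-back {n} {a} {d} a+d≤n = +-cancelʳ-≡ (a + d) _ (n ∸ d) (begin
  dist n (a + d) a + (a + d)  ≡⟨ dist-≥ (m≤m+n a d) a+d≤n ⟩
  a + n                       ≡⟨ cong (a +_) (sym (m∸n+n≡m (≤-trans (m≤n+m d a) a+d≤n))) ⟩
  a + (n ∸ d + d)             ≡⟨ x∙yz≈y∙xz a (n ∸ d) d ⟩
  n ∸ d + (a + d)             ∎)
  where open ≡-Reasoning

dist≡⇒≡+ : ∀ {n x a d} → dist n x a ≡ d → x + d < n → a ≡ x + d
dist≡⇒≡+ {n} {x} {a} {d} refl x+d<n with <-≤-connex x a
... | inj₁ x<a = trans (sym (dist-< x<a)) (+-comm d x)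
... | inj₂ a≤x = contradiction n≤x+d (<⇒≱ x+d<n)
  where
  n≤x+d : n ≤ x + d
  n≤x+d = begin
    n      ≤⟨ m≤n+m n a ⟩
    a + n  ≡⟨ sym (dist-≥ a≤x (≤-trans (m≤m+n x d) (<⇒≤ x+d<n))) ⟩
    d + x  ≡⟨ +-comm d x ⟩
    x + d  ∎
    where open ≤-Reasoning

≤⇔+-≤ : ∀ {d e} k {u v} → d + k ≡ u → e + k ≡ v → d ≤ e ⇔ u ≤ v
≤⇔+-≤ k refl refl = mk⇔ (+-monoˡ-≤ k) (+-cancelʳ-≤ k _ _)

-- In each case both sides reduce to the same comparison of a and b (or are both true, or both false).
crossing⇔dist-≤-step : ∀ {n x a b} → suc x < n → a < n → b < n →
                       a ≢ x → a ≢ suc x → b ≢ x → b ≢ suc x →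
                       Cross x a (suc x) b ⇔ dist n x a ≤ dist n (suc x) b
crossing⇔dist-≤-step {n} {x} {a} {b} 1+x<n a<n b<n a≢x a≢1+x b≢x b≢1+x with <-cmp x a | <-cmp (suc x) b
... | tri≈ _ x≡a _ | _ = contradiction (sym x≡a) a≢x
... | _ | tri≈ _ 1+x≡b _ = contradiction (sym 1+x≡b) b≢1+x
... | tri< x<a _ _ | tri< 1+x<b _ _ = ⇔-trans
  (mk⇔ (a<b ∘ Cross-elim (<⇒≤ x<a) (<⇒≤ 1+x<b))
       (Cross-intro (n<1+n x) (≤∧≢⇒< x<a (a≢1+x ∘ sym))))
  (⇔-sym (≤⇔+-≤ (suc x) (dist-<-suc x<a) (dist-< 1+x<b)))
  where
  a<b : Interleaved x a (suc x) b → a < b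
  a<b (inj₁ (_ , _ , a<b)) = a<b
  a<b (inj₂ (1+x<x , _)) = contradiction 1+x<x (<-asym (n<1+n x))
... | tri< x<a _ _ | tri> _ _ b<1+x = mk⇔
  (λ _ → Equivalence.from (≤⇔+-≤ (suc x) (dist-<-suc x<a) (dist-≥ (<⇒≤ b<1+x) (<⇒≤ 1+x<n)))
                          (≤-trans a<n (m≤n+m n b)))
  (λ _ → Cross-swapʳ (Cross-sym (Cross-intro b<x (n<1+n x) (≤∧≢⇒< x<a (a≢1+x ∘ sym)))))
  where
  b<x : b < x
  b<x = ≤∧≢⇒< (≤-pred b<1+x) b≢x
... | tri> _ _ a<x | tri< 1+x<b _ _ = mk⇔
  (λ c → contradiction (Cross-elim (<⇒≤ a<x) (<⇒≤ 1+x<b) (Cross-swapˡ c)) apart)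
  (λ le → ⊥-elim (<⇒≱ (<-≤-trans b<n (m≤n+m n (suc a)))
                      (Equivalence.to (≤⇔+-≤ (suc x) (dist-≥-suc (<⇒≤ a<x) x<n) (dist-< 1+x<b)) le)))
  where
  x<n : x < n
  x<n = <-trans (n<1+n x) 1+x<n
  apart : ¬ Interleaved a x (suc x) b
  apart (inj₁ (_ , 1+x<x , _)) = <-asym (n<1+n x) 1+x<x
  apart (inj₂ (1+x<a , _)) = <-asym a<x (<-trans (n<1+n x) 1+x<a)
... | tri> _ _ a<x | tri> _ _ b<1+x = ⇔-trans
  (mk⇔ (a<b ∘ Cross-elim (<⇒≤ a<x) (<⇒≤ b<1+x) ∘ Cross-swapʳ ∘ Cross-swapˡ)
       (λ a<b → Cross-swapʳ (Cross-swapˡ (Cross-intro a<b b<x (n<1+n x)))))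
  (⇔-sym (⇔-trans (≤⇔+-≤ (suc x) (dist-≥-suc (<⇒≤ a<x) (<-trans (n<1+n x) 1+x<n))
                                  (dist-≥ (<⇒≤ b<1+x) (<⇒≤ 1+x<n)))
                  (mk⇔ (+-cancelʳ-≤ n _ _) (+-monoˡ-≤ n))))
  where
  b<x : b < x
  b<x = ≤∧≢⇒< (≤-pred b<1+x) b≢x
  a<b : Interleaved a x b (suc x) → a < b
  a<b (inj₁ (a<b , _)) = a<b
  a<b (inj₂ (_ , _ , 1+x<x)) = contradiction 1+x<x (<-asym (n<1+n x))
crossing⇔dist-≤-wrap : ∀ {x a b} → a < suc x → b < suc x → a ≢ x → a ≢ 0 → b ≢ x → b ≢ 0 →
                       Cross x a 0 b ⇔ dist (suc x) x a ≤ dist (suc x) 0 b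
crossing⇔dist-≤-wrap {x} {a} {b} a<n b<n a≢x a≢0 b≢x b≢0 = ⇔-trans
  (mk⇔ (a<b ∘ Cross-elim (<⇒≤ a<x) (z≤n {b}) ∘ Cross-swapˡ {x} {a} {0})
       (λ a<b → Cross-swapˡ {a} {x} {0} (Cross-sym {0} {b} (Cross-intro (n≢0⇒n>0 a≢0) a<b b<x))))
  (⇔-sym (⇔-trans (≤⇔+-≤ x (trans (dist-≥ (<⇒≤ a<x) (n≤1+n x)) (+-suc a x))
                             (cong (_+ x) (trans (sym (+-identityʳ _)) (dist-< (n≢0⇒n>0 b≢0)))))
                  (mk⇔ (+-cancelʳ-≤ x _ _) (+-monoˡ-≤ x))))
  where
  a<x : a < x
  a<x = ≤∧≢⇒< (≤-pred a<n) a≢x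
  b<x : b < x
  b<x = ≤∧≢⇒< (≤-pred b<n) b≢x
  a<b : Interleaved a x 0 b → a < b
  a<b (inj₂ (_ , a<b , _)) = a<b

crossing⇔dist-≤ : ∀ {n x y a b} → CyclicSucc n x y → a < n → b < n →
                  a ≢ x → a ≢ y → b ≢ x → b ≢ y → Cross x a y b ⇔ dist n x a ≤ dist n y b
crossing⇔dist-≤ (inj₁ (1+x<n , refl)) = crossing⇔dist-≤-step 1+x<n
crossing⇔dist-≤ (inj₂ (refl , refl)) = crossing⇔dist-≤-wrap

nxt-cyclicSucc : ∀ {n} (i : Fin n) → CyclicSucc n (toℕ i) (toℕ (nxt i))
nxt-cyclicSucc {suc n} i with suc (toℕ i) <? suc n
... | yes 1+i<n = inj₁ (1+i<n , toℕ-fromℕ< 1+i<n)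
... | no 1+i≮n = inj₂ (≤-antisym (toℕ<n i) (≮⇒≥ 1+i≮n) , refl)

toℕ-nxt : ∀ {n} (i : Fin n) → suc (toℕ i) < n → toℕ (nxt i) ≡ suc (toℕ i)
toℕ-nxt i 1+i<n with nxt-cyclicSucc i
... | inj₁ (_ , e) = e
... | inj₂ (1+i≡n , _) = contradiction 1+i≡n (<⇒≢ 1+i<n)

nxt-inject₁ : ∀ {n} (i : Fin n) → nxt (inject₁ i) ≡ fsuc i
nxt-inject₁ {n} i = toℕ-injective (trans (toℕ-nxt (inject₁ i) (s<s i<n)) (cong suc (toℕ-inject₁ i)))
  where
  i<n : toℕ (inject₁ i) < n
  i<n = subst (_< n) (sym (toℕ-inject₁ i)) (toℕ<n i)

nxt-fromℕ : ∀ n → nxt (fromℕ n) ≡ fzero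
nxt-fromℕ n with nxt-cyclicSucc (fromℕ n)
... | inj₁ (1+n<1+n , _) = ⊥-elim (<-irrefl refl (subst (λ k → suc k < suc n) (toℕ-fromℕ n) 1+n<1+n))
... | inj₂ (_ , e) = toℕ-injective e

nxt-surjective : ∀ {n} (j : Fin n) → ∃ λ i → nxt i ≡ j
nxt-surjective {suc n} fzero = fromℕ n , nxt-fromℕ n
nxt-surjective (fsuc j) = inject₁ j , nxt-inject₁ j

nxt-closed : ∀ {n ℓ} (P : Fin n → Set ℓ) {i} → P i → (∀ p → P p → P (nxt p)) → ∀ j → P j
nxt-closed {suc n} P {i} Pi P⇒Pnxt = <-weakInduction P P₀ P⇒Psuc
  where
  P⇒Psuc : ∀ j → P (inject₁ j) → P (fsuc j)
  P⇒Psuc j = subst P (nxt-inject₁ j) ∘ P⇒Pnxt (inject₁ j)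
  P₀ : P fzero
  P₀ = subst P (nxt-fromℕ n) (P⇒Pnxt _ (<-weakInduction-startingFrom P Pi P⇒Psuc (≤fromℕ i)))

nxt-monotone⇒constant : ∀ {n} (f : Fin n → ℕ) → (∀ p → f p ≤ f (nxt p)) → ∀ i j → f i ≡ f j
nxt-monotone⇒constant f monotone i j = ≤-antisym (reach i j) (reach j i)
  where
  reach : ∀ i j → f i ≤ f j
  reach i = nxt-closed (λ j → f i ≤ f j) ≤-refl (λ p fi≤fp → ≤-trans fi≤fp (monotone p))

sum-map-const : ∀ {A : Set} {f : A → ℕ} {c} → (∀ x → f x ≡ c) →
                ∀ xs → sum (map f xs) ≡ length xs * c
sum-map-const fx≡c [] = refl
sum-map-const fx≡c (x ∷ xs) = cong₂ _+_ (fx≡c x) (sum-map-const fx≡c xs)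

sum-map≤length : ∀ {A : Set} {f : A → ℕ} → (∀ x → f x ≤ 1) → ∀ xs → sum (map f xs) ≤ length xs
sum-map≤length fx≤1 [] = z≤n
sum-map≤length fx≤1 (x ∷ xs) = +-mono-≤ (fx≤1 x) (sum-map≤length fx≤1 xs)

sum-map≡length⇒all≡1 : ∀ {A : Set} {f : A → ℕ} → (∀ x → f x ≤ 1) →
                       ∀ xs → sum (map f xs) ≡ length xs → All (λ x → f x ≡ 1) xs
sum-map≡length⇒all≡1 fx≤1 [] _ = []
sum-map≡length⇒all≡1 {f = f} fx≤1 (x ∷ xs) sum≡length with n≤1⇒n≡0∨n≡1 (fx≤1 x)
... | inj₁ fx≡0 = ⊥-elim (1+n≰n (subst (_≤ length xs) rest≡1+len (sum-map≤length fx≤1 xs)))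
  where
  rest≡1+len : sum (map f xs) ≡ suc (length xs)
  rest≡1+len = subst (λ k → k + sum (map f xs) ≡ suc (length xs)) fx≡0 sum≡length
... | inj₂ fx≡1 = fx≡1 ∷ sum-map≡length⇒all≡1 fx≤1 xs
  (suc-injective (subst (λ k → k + sum (map f xs) ≡ suc (length xs)) fx≡1 sum≡length))

isUnmatched : ∀ {A : Set} → Maybe A → ℕ
isUnmatched x = if is-nothing x then 1 else 0

isUnmatched≤1 : ∀ {A : Set} (x : Maybe A) → isUnmatched x ≤ 1
isUnmatched≤1 (just _) = z≤n
isUnmatched≤1 nothing = ≤-refl

all-unmatched⇒unmatched≡n : ∀ {n} {m : PartnerMap n} → (∀ i → m i ≡ nothing) → unmatched m ≡ n
all-unmatched⇒unmatched≡n {n} m≡nothing =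
  trans (sum-map-const (λ i → cong isUnmatched (m≡nothing i)) (allFin n))
        (trans (*-identityʳ _) (length-tabulate id))

all-matched⇒unmatched≡0 : ∀ {n} {m : PartnerMap n} → (∀ i → ∃ λ j → m i ≡ just j) →
                          unmatched m ≡ 0
all-matched⇒unmatched≡0 {n} matched =
  trans (sum-map-const (λ i → cong isUnmatched (proj₂ (matched i))) (allFin n)) (*-zeroʳ (length (allFin n)))

unmatched≡n⇒all-unmatched : ∀ {n} {m : PartnerMap n} → unmatched m ≡ n → ∀ i → m i ≡ nothing
unmatched≡n⇒all-unmatched {n} {m} unmatched≡n i =
  isUnmatched≡1⇒nothing (m i) (All.lookup all≡1 (∈-allFin i))
  where
  all≡1 : All (λ i → isUnmatched (m i) ≡ 1) (allFin n)
  all≡1 = sum-map≡length⇒all≡1 (isUnmatched≤1 ∘ m) (allFin n)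
                               (trans unmatched≡n (sym (length-tabulate id)))
  isUnmatched≡1⇒nothing : ∀ {A : Set} (x : Maybe A) → isUnmatched x ≡ 1 → x ≡ nothing
  isUnmatched≡1⇒nothing nothing _ = refl

-- Descents

Antipodal : ∀ {n} → PartnerMap n → ℕ → Set
Antipodal {n} m h = ∀ (i j : Fin n) → toℕ i < h → toℕ j ≡ toℕ i + h → m i ≡ just j

opaque
  -- measured clockwise from p; 0 when p is unmatched
  chordLength : ∀ {n} → PartnerMap n → Fin n → ℕ
  chordLength {n} m p = maybe′ (λ a → dist n (toℕ p) (toℕ a)) 0 (m p)

  chordLength-just : ∀ {n} {m : PartnerMap n} {p a} →
                     m p ≡ just a → chordLength m p ≡ dist n (toℕ p) (toℕ a)
  chordLength-just {n} {p = p} = cong (maybe′ (λ a → dist n (toℕ p) (toℕ a)) 0)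

module _ {n} {m : PartnerMap n} (pm : IsPartialMatching m) where
  open IsPartialMatching pm

  partner-unique : ∀ {p a b} → m p ≡ just a → m p ≡ just b → a ≡ b
  partner-unique ma mb = just-injective (trans (sym ma) mb)

  descent⇒nxt-matched : ∀ {p} → InCMDes m p → ∃ λ b → m (nxt p) ≡ just b
  descent⇒nxt-matched (chord e) = _ , symmetric _ _ e
  descent⇒nxt-matched (crossing _ b _ e _ _) = b , e
  descent⇒nxt-matched (unmatchedThenMatched _ b e) = b , e

  all-descents⇒matched : (∀ p → InCMDes m p) → ∀ j → ∃ λ b → m j ≡ just b
  all-descents⇒matched everyDescent j with nxt-surjective j
  ... | p , refl = descent⇒nxt-matched (everyDescent p)

  all-unmatched⇒no-descent : (∀ i → m i ≡ nothing) → ∀ i → ¬ InCMDes m i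
  all-unmatched⇒no-descent unmatched p d with trans (sym (proj₂ (descent⇒nxt-matched d))) (unmatched (nxt p))
  ... | ()

  no-descent⇒unmatched-closed : (∀ i → ¬ InCMDes m i) → ∀ p → m p ≡ nothing → m (nxt p) ≡ nothing
  no-descent⇒unmatched-closed noDescent p mp with m (nxt p) in mq
  ... | nothing = refl
  ... | just b = contradiction (unmatchedThenMatched mp b mq) (noDescent p)

  no-descent⇒all-matched : (∀ i → ¬ InCMDes m i) → ∀ {i b} → m i ≡ just b → ∀ j → m j ≢ nothing
  no-descent⇒all-matched noDescent {i} mi j mj
    with trans (sym mi) (nxt-closed (λ p → m p ≡ nothing) mj (no-descent⇒unmatched-closed noDescent) i)
  ... | ()

  no-descent⇒no-forward-chord : (∀ i → ¬ InCMDes m i) → (∀ i → m i ≢ nothing) →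
                                 ∀ {a b} → Acc Fin._<_ b → toℕ a < toℕ b → m a ≡ just b → ⊥
  no-descent⇒no-forward-chord noDescent matched {a} {b} (acc rec) a<b ma with b ≟ nxt a | m (nxt a) in mc
  ... | yes refl | _ = noDescent a (chord ma)
  ... | no _ | nothing = matched (nxt a) mc
  ... | no b≢y | just c = inside (Fin.<-cmp c a) (Fin.<-cmp c b)
    where
    y≡1+a : toℕ (nxt a) ≡ suc (toℕ a)
    y≡1+a = toℕ-nxt a (≤-<-trans a<b (toℕ<n b))
    1+a<b : suc (toℕ a) < toℕ b
    1+a<b = ≤∧≢⇒< a<b (λ 1+a≡b → b≢y (toℕ-injective (trans (sym 1+a≡b) (sym y≡1+a))))
    descent : Cross (toℕ a) (toℕ b) (suc (toℕ a)) (toℕ c) → ⊥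
    descent cr =
      noDescent a (crossing b c ma mc b≢y (subst (λ y → Cross (toℕ a) (toℕ b) y (toℕ c)) (sym y≡1+a) cr))
    y≢c : nxt a ≢ c
    y≢c refl = irreflexive _ mc
    inside : Tri (c Fin.< a) (c ≡ a) (a Fin.< c) → Tri (c Fin.< b) (c ≡ b) (b Fin.< c) → ⊥
    inside (tri< c<a _ _) _ = descent (Cross-swapʳ (Cross-sym (Cross-intro c<a (n<1+n (toℕ a)) 1+a<b)))
    inside (tri≈ _ refl _) _ = b≢y (partner-unique ma (symmetric _ _ mc))
    inside (tri> _ _ a<c) (tri< c<b _ _) = no-descent⇒no-forward-chord noDescent matched (rec c<b) y<c mc
      where
      y<c : toℕ (nxt a) < toℕ c
      y<c = ≤∧≢⇒< (subst (_≤ toℕ c) (sym y≡1+a) a<c) (y≢c ∘ toℕ-injective)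
    inside _ (tri≈ _ refl _) =
      <-irrefl (trans (cong toℕ (partner-unique (symmetric _ _ ma) (symmetric _ _ mc))) y≡1+a) (n<1+n (toℕ a))
    inside _ (tri> _ _ b<c) = descent (Cross-intro (n<1+n (toℕ a)) 1+a<b b<c)

  no-descent⇒all-unmatched : (∀ i → ¬ InCMDes m i) → ∀ i → m i ≡ nothing
  no-descent⇒all-unmatched noDescent i with m i in mi
  ... | nothing = refl
  ... | just b = ⊥-elim (oriented (Fin.<-cmp i b))
    where
    no-forward-chord : ∀ {a c} → Acc Fin._<_ c → toℕ a < toℕ c → m a ≡ just c → ⊥
    no-forward-chord = no-descent⇒no-forward-chord noDescent (no-descent⇒all-matched noDescent mi)
    oriented : Tri (i Fin.< b) (i ≡ b) (b Fin.< i) → ⊥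
    oriented (tri< i<b _ _) = no-forward-chord (<-wellFounded b) i<b mi
    oriented (tri≈ _ refl _) = irreflexive i mi
    oriented (tri> _ _ b<i) = no-forward-chord (<-wellFounded i) b<i (symmetric _ _ mi)

  descent⇔crossing : ∀ {p a b} → m p ≡ just a → m (nxt p) ≡ just b → a ≢ nxt p →
                     InCMDes m p ⇔ Cross (toℕ p) (toℕ a) (toℕ (nxt p)) (toℕ b)
  descent⇔crossing {p} {a} {b} ma mb a≢y = mk⇔ to (crossing a b ma mb a≢y)
    where
    to : InCMDes m p → Cross (toℕ p) (toℕ a) (toℕ (nxt p)) (toℕ b)
    to (chord e) = contradiction (partner-unique ma e) a≢y
    to (crossing _ _ e₁ e₂ _ c) with partner-unique ma e₁ | partner-unique mb e₂
    ... | refl | refl = c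
    to (unmatchedThenMatched e _ _) with trans (sym ma) e
    ... | ()

  descent⇔chordLength-≤ : ∀ {p a b} → m p ≡ just a → m (nxt p) ≡ just b →
                          InCMDes m p ⇔ chordLength m p ≤ chordLength m (nxt p)
  descent⇔chordLength-≤ {p} {a} {b} ma mb with a ≟ nxt p
  ... | yes refl = mk⇔
    (λ _ → subst₂ _≤_ (sym (trans (chordLength-just ma) (dist-successor (nxt-cyclicSucc p))))
                      (sym (chordLength-just mb)) (dist-pos (toℕ b) (toℕ<n (nxt p))))
    (λ _ → chord ma)
  ... | no a≢y = ⇔-trans (descent⇔crossing ma mb a≢y)
    (subst₂ (λ u v → Cross (toℕ p) (toℕ a) (toℕ (nxt p)) (toℕ b) ⇔ u ≤ v)
            (sym (chordLength-just ma)) (sym (chordLength-just mb))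
            (crossing⇔dist-≤ (nxt-cyclicSucc p) (toℕ<n a) (toℕ<n b)
              (a≢p ∘ toℕ-injective) (a≢y ∘ toℕ-injective)
              (b≢p ∘ toℕ-injective) (b≢y ∘ toℕ-injective)))
    where
    a≢p : a ≢ p
    a≢p refl = irreflexive _ ma
    b≢p : b ≢ p
    b≢p refl = a≢y (partner-unique ma (symmetric _ _ mb))
    b≢y : b ≢ nxt p
    b≢y refl = irreflexive _ mb

all-descents⇒antipodal : ∀ {n} {m : PartnerMap n} → IsPartialMatching m →
                         (∀ p → InCMDes m p) → ∃ λ h → n ≡ h + h × Antipodal m h
all-descents⇒antipodal {zero} _ _ = 0 , refl , λ ()
all-descents⇒antipodal {suc n} {m} pm everyDescent with all-descents⇒matched pm everyDescent fzero
... | a , ma = h , 1+n≡h+h , antipodal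
  where
  open IsPartialMatching pm
  matched : ∀ j → ∃ λ b → m j ≡ just b
  matched = all-descents⇒matched pm everyDescent

  h : ℕ
  h = chordLength m fzero

  chordLength-constant : ∀ i → chordLength m i ≡ h
  chordLength-constant i = nxt-monotone⇒constant (chordLength m) monotone i fzero
    where
    monotone : ∀ p → chordLength m p ≤ chordLength m (nxt p)
    monotone p = Equivalence.to (descent⇔chordLength-≤ pm (proj₂ (matched p)) (proj₂ (matched (nxt p))))
                                (everyDescent p)

  a≢0 : a ≢ fzero
  a≢0 refl = irreflexive _ ma

  h≡a : h ≡ toℕ a
  h≡a = trans (chordLength-just ma)
              (trans (sym (+-identityʳ _)) (dist-< (n≢0⇒n>0 (a≢0 ∘ toℕ-injective))))

  1+n≡h+h : suc n ≡ h + h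
  1+n≡h+h = begin
    suc n                           ≡⟨ sym (dist-≥ z≤n (<⇒≤ (toℕ<n a))) ⟩
    dist (suc n) (toℕ a) 0 + toℕ a  ≡⟨ cong₂ _+_ (trans (sym (chordLength-just (symmetric _ _ ma)))
                                                        (chordLength-constant a))
                                                 (sym h≡a) ⟩
    h + h                           ∎
    where open ≡-Reasoning

  antipodal : Antipodal m h
  antipodal i j i<h j≡i+h with matched i
  ... | b , mb = subst (λ c → m i ≡ just c) (toℕ-injective (trans b≡i+h (sym j≡i+h))) mb
    where
    b≡i+h : toℕ b ≡ toℕ i + h
    b≡i+h = dist≡⇒≡+ (trans (sym (chordLength-just mb)) (chordLength-constant i))
                     (subst (toℕ i + h <_) (sym 1+n≡h+h) (+-monoˡ-< h i<h))

antipodal⇒partner : ∀ {n h} {m : PartnerMap n} → IsPartialMatching m → n ≡ h + h → Antipodal m h →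
                    ∀ p → ∃ λ a → m p ≡ just a × chordLength m p ≡ h
antipodal⇒partner {n} {h} {m} pm n≡h+h antipodal p with toℕ p <? h
... | yes p<h =
  a , ma , trans (chordLength-just ma) (trans (cong (dist n (toℕ p)) a≡p+h) (dist-+ (≤-<-trans z≤n p<h)))
  where
  p+h<n : toℕ p + h < n
  p+h<n = subst (toℕ p + h <_) (sym n≡h+h) (+-monoˡ-< h p<h)
  a : Fin n
  a = fromℕ< p+h<n
  a≡p+h : toℕ a ≡ toℕ p + h
  a≡p+h = toℕ-fromℕ< p+h<n
  ma : m p ≡ just a
  ma = antipodal p a p<h a≡p+h
... | no p≮h = a , ma , trans (chordLength-just ma) (trans (cong (λ x → dist n x (toℕ a)) p≡a+h) a+h↦a)
  where
  a<n : toℕ p ∸ h < n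
  a<n = ≤-<-trans (m∸n≤m (toℕ p) h) (toℕ<n p)
  a : Fin n
  a = fromℕ< a<n
  p≡a+h : toℕ p ≡ toℕ a + h
  p≡a+h = trans (sym (m∸n+n≡m (≮⇒≥ p≮h))) (cong (_+ h) (sym (toℕ-fromℕ< a<n)))
  a<h : toℕ a < h
  a<h = +-cancelʳ-< h _ h (subst₂ _<_ p≡a+h n≡h+h (toℕ<n p))
  ma : m p ≡ just a
  ma = IsPartialMatching.symmetric pm a p (antipodal a p a<h p≡a+h)
  a+h↦a : dist n (toℕ a + h) (toℕ a) ≡ h
  a+h↦a = trans (dist-back (subst (toℕ a + h ≤_) (sym n≡h+h) (+-monoˡ-≤ h (<⇒≤ a<h))))
                (trans (cong (_∸ h) n≡h+h) (m+n∸n≡m h h))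

antipodal⇒all-descents : ∀ {n h} {m : PartnerMap n} → IsPartialMatching m → n ≡ h + h →
                         Antipodal m h → ∀ p → InCMDes m p
antipodal⇒all-descents pm n≡h+h antipodal p
  with antipodal⇒partner pm n≡h+h antipodal p | antipodal⇒partner pm n≡h+h antipodal (nxt p)
... | _ , ma , ℓp≡h | _ , mb , ℓq≡h =
  Equivalence.from (descent⇔chordLength-≤ pm ma mb) (≤-reflexive (trans ℓp≡h (sym ℓq≡h)))

-- Crossings

StrictlyIncreasing : ∀ {r} → (Fin r → ℕ) → Set
StrictlyIncreasing g = ∀ s t → toℕ s < toℕ t → g s < g t

strictly-increasing⇒spread : ∀ {r} (g : Fin (suc r) → ℕ) → StrictlyIncreasing g →
                             ∀ {s t} → toℕ s ≤ toℕ t → toℕ t + g s ≤ toℕ s + g t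
strictly-increasing⇒spread g increasing {s} =
  <-weakInduction-startingFrom (λ t → toℕ t + g s ≤ toℕ s + g t) ≤-refl step
  where
  step : ∀ j → toℕ (inject₁ j) + g s ≤ toℕ s + g (inject₁ j) →
               suc (toℕ j) + g s ≤ toℕ s + g (fsuc j)
  step j ih = begin
    suc (toℕ j + g s)             ≡⟨ cong (λ x → suc (x + g s)) (sym (toℕ-inject₁ j)) ⟩
    suc (toℕ (inject₁ j) + g s)   ≤⟨ s≤s ih ⟩
    suc (toℕ s + g (inject₁ j))   ≡⟨ sym (+-suc (toℕ s) _) ⟩
    toℕ s + suc (g (inject₁ j))   ≤⟨ +-monoʳ-≤ (toℕ s) (increasing _ _ j<1+j) ⟩
    toℕ s + g (fsuc j)            ∎
    where
    open ≤-Reasoning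
    j<1+j : toℕ (inject₁ j) < suc (toℕ j)
    j<1+j = s≤s (≤-reflexive (toℕ-inject₁ j))

strictly-increasing⇒last : ∀ {r} (g : Fin (suc r) → ℕ) → StrictlyIncreasing g →
                           ∀ t → r + g t ≤ toℕ t + g (fromℕ r)
strictly-increasing⇒last {r} g increasing t =
  subst (λ x → x + g t ≤ toℕ t + g (fromℕ r)) (toℕ-fromℕ r)
        (strictly-increasing⇒spread g increasing (≤fromℕ t))

strictly-increasing-below⇒length≤ : ∀ {r} (g : Fin (suc r) → ℕ) → StrictlyIncreasing g →
                                    ∀ {b} → (∀ t → g t < b) → suc r ≤ b
strictly-increasing-below⇒length≤ {r} g increasing g<b =
  ≤-<-trans (≤-trans (m≤m+n r (g fzero)) (strictly-increasing⇒last g increasing fzero)) (g<b (fromℕ r))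

strictly-increasing-tight : ∀ {r} (g : Fin (suc r) → ℕ) → StrictlyIncreasing g → ∀ {lo} →
                            lo ≤ g fzero → g (fromℕ r) ≤ r + lo → ∀ t → g t ≡ toℕ t + lo
strictly-increasing-tight {r} g increasing {lo} lo≤first last≤r+lo t = ≤-antisym upper lower
  where
  lower : toℕ t + lo ≤ g t
  lower = ≤-trans (+-monoʳ-≤ (toℕ t) lo≤first) (strictly-increasing⇒spread g increasing z≤n)
  upper : g t ≤ toℕ t + lo
  upper = +-cancelˡ-≤ r _ _ (begin
    r + g t              ≤⟨ strictly-increasing⇒last g increasing t ⟩
    toℕ t + g (fromℕ r)  ≤⟨ +-monoʳ-≤ (toℕ t) last≤r+lo ⟩
    toℕ t + (r + lo)     ≡⟨ x∙yz≈y∙xz (toℕ t) r lo ⟩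
    r + (toℕ t + lo)     ∎)
    where open ≤-Reasoning

crossing-bound : ∀ {n r} {m : PartnerMap n} → HasCrossing m r → r + r ≤ n
crossing-bound {r = zero} _ = z≤n
crossing-bound {n} {suc r} (is , js , _ , is-increasing , js-increasing , is<js) = begin
  suc (r + suc r)           ≤⟨ s≤s (+-monoʳ-≤ r h≤js0) ⟩
  suc (r + toℕ (js fzero))  ≤⟨ s≤s (strictly-increasing⇒last (toℕ ∘ js) js-increasing fzero) ⟩
  suc (toℕ (js (fromℕ r)))  ≤⟨ toℕ<n (js (fromℕ r)) ⟩
  n                         ∎
  where
  open ≤-Reasoning
  h≤js0 : suc r ≤ toℕ (js fzero)
  h≤js0 = strictly-increasing-below⇒length≤ (toℕ ∘ is) is-increasing (λ t → is<js t fzero)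

maximal-crossing⇒antipodal : ∀ {n h} {m : PartnerMap n} → n ≡ h + h → HasCrossing m h → Antipodal m h
maximal-crossing⇒antipodal {h = zero} _ _ _ _ ()
maximal-crossing⇒antipodal {n} {suc r} {m} n≡h+h (is , js , mij , is-increasing , js-increasing , is<js)
                           i j i<h j≡i+h =
  subst₂ (λ x y → m x ≡ just y) (toℕ-injective is-t≡i) (toℕ-injective js-t≡j) (mij t)
  where
  t : Fin (suc r)
  t = fromℕ< i<h
  jsL<h+h : toℕ (js (fromℕ r)) < suc r + suc r
  jsL<h+h = subst (toℕ (js (fromℕ r)) <_) n≡h+h (toℕ<n _)
  h≤js0 : suc r ≤ toℕ (js fzero)
  h≤js0 = strictly-increasing-below⇒length≤ (toℕ ∘ is) is-increasing (λ t → is<js t fzero)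
  js0≤h : toℕ (js fzero) ≤ suc r
  js0≤h = +-cancelˡ-≤ r _ _
    (≤-pred (≤-trans (s≤s (strictly-increasing⇒last (toℕ ∘ js) js-increasing fzero)) jsL<h+h))
  isL≤r : toℕ (is (fromℕ r)) ≤ r + 0
  isL≤r = subst (toℕ (is (fromℕ r)) ≤_) (sym (+-identityʳ r))
                (≤-pred (<-≤-trans (is<js (fromℕ r) fzero) js0≤h))
  is-t≡i : toℕ (is t) ≡ toℕ i
  is-t≡i = trans (strictly-increasing-tight (toℕ ∘ is) is-increasing z≤n isL≤r t)
                 (trans (+-identityʳ _) (toℕ-fromℕ< i<h))
  js-t≡j : toℕ (js t) ≡ toℕ j
  js-t≡j = trans (strictly-increasing-tight (toℕ ∘ js) js-increasing h≤js0 (≤-pred jsL<h+h) t)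
                 (trans (cong (_+ suc r) (toℕ-fromℕ< i<h)) (sym j≡i+h))

antipodal⇒crossing : ∀ {n h} {m : PartnerMap n} → n ≡ h + h → Antipodal m h → HasCrossing m h
antipodal⇒crossing {n} {h} n≡h+h antipodal = is , js
  , (λ t → antipodal (is t) (js t) (subst (_< h) (sym (toℕ-is t)) (toℕ<n t))
                     (trans (toℕ-js t) (cong (_+ h) (sym (toℕ-is t)))))
  , (λ s t s<t → subst₂ _<_ (sym (toℕ-is s)) (sym (toℕ-is t)) s<t)
  , (λ s t s<t → subst₂ _<_ (sym (toℕ-js s)) (sym (toℕ-js t)) (+-monoˡ-< h s<t))
  , (λ s t → subst₂ _<_ (sym (toℕ-is s)) (sym (toℕ-js t)) (<-≤-trans (toℕ<n s) (m≤n+m h (toℕ t))))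
  where
  t+h<n : (t : Fin h) → toℕ t + h < n
  t+h<n t = subst (toℕ t + h <_) (sym n≡h+h) (+-monoˡ-< h (toℕ<n t))
  is js : Fin h → Fin n
  is t = fromℕ< (≤-<-trans (m≤m+n (toℕ t) h) (t+h<n t))
  js t = fromℕ< (t+h<n t)
  toℕ-is : ∀ t → toℕ (is t) ≡ toℕ t
  toℕ-is t = toℕ-fromℕ< _
  toℕ-js : ∀ t → toℕ (js t) ≡ toℕ t + h
  toℕ-js t = toℕ-fromℕ< _

antipodal⇒crn : ∀ {n h} {m : PartnerMap n} → n ≡ h + h → Antipodal m h → IsCrn m h
antipodal⇒crn {m = m} n≡h+h antipodal = antipodal⇒crossing n≡h+h antipodal , λ r crossing →
  ≮⇒≥ (λ h<r → <⇒≱ (+-mono-< h<r h<r) (subst (r + r ≤_) n≡h+h (crossing-bound {m = m} crossing)))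

half-of-double : ∀ {n} h → n ≡ h + h → ⌊ n /2⌋ ≡ h
half-of-double h refl = sym (n≡⌊n+n/2⌋ h)

double⇒even : ∀ {n} h → n ≡ h + h → 2 ∣ n
double⇒even h refl = divides h (trans (cong (h +_) (sym (+-identityʳ h))) (*-comm 2 h))

even⇒halves : ∀ {n} → 2 ∣ n → n ≡ ⌊ n /2⌋ + ⌊ n /2⌋
even⇒halves {n} (divides q n≡q*2) = subst (λ h → n ≡ h + h) (sym (half-of-double q n≡q+q)) n≡q+q
  where
  n≡q+q : n ≡ q + q
  n≡q+q = trans n≡q*2 (trans (*-comm q 2) (cong (q +_) (+-identityʳ q)))

all-descents⇒antipodal-halves : ∀ {n} {m : PartnerMap n} → IsPartialMatching m → (∀ p → InCMDes m p) →
                                n ≡ ⌊ n /2⌋ + ⌊ n /2⌋ × Antipodal m ⌊ n /2⌋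
all-descents⇒antipodal-halves pm everyDescent with all-descents⇒antipodal pm everyDescent
... | h , n≡h+h , antipodal rewrite half-of-double h n≡h+h = n≡h+h , antipodal

lemma5p2 : (n k : ℕ) → k ≤ n → 2 ∣ (n ∸ k) → (m : Matching n k) →
    ((∀ i → ¬ InCMDes (partner m) i) ⇔ (k ≡ n))
    × ((∀ i → InCMDes (partner m) i) ⇔ (k ≡ 0 × IsCrn (partner m) ⌊ n /2⌋))
    × ((∀ i → InCMDes (partner m) i)
        ⇔ (2 ∣ n × (∀ (i j : Fin n) → toℕ i < ⌊ n /2⌋ → toℕ j ≡ toℕ i + ⌊ n /2⌋
                     → partner m i ≡ just j)))
lemma5p2 n k _ 2∣n∸k M = no-descents⇔k≡n , all-descents⇔crn , all-descents⇔antipodal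
  where
  m : PartnerMap n
  m = partner M
  pm : IsPartialMatching m
  pm = isMatching M

  no-descents⇔k≡n : (∀ i → ¬ InCMDes m i) ⇔ (k ≡ n)
  no-descents⇔k≡n = mk⇔
    (λ noDescent → trans (sym (numUnmatched M))
                         (all-unmatched⇒unmatched≡n (no-descent⇒all-unmatched pm noDescent)))
    (λ k≡n → all-unmatched⇒no-descent pm (unmatched≡n⇒all-unmatched (trans (numUnmatched M) k≡n)))

  all-descents⇔crn : (∀ i → InCMDes m i) ⇔ (k ≡ 0 × IsCrn m ⌊ n /2⌋)
  all-descents⇔crn = mk⇔
    (λ everyDescent →
         trans (sym (numUnmatched M)) (all-matched⇒unmatched≡0 (all-descents⇒matched pm everyDescent))
       , uncurry antipodal⇒crn (all-descents⇒antipodal-halves pm everyDescent))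
    (λ { (refl , crn) → antipodal⇒all-descents pm (even⇒halves 2∣n∸k)
                          (maximal-crossing⇒antipodal (even⇒halves 2∣n∸k) (proj₁ crn)) })

  all-descents⇔antipodal : (∀ i → InCMDes m i) ⇔ (2 ∣ n × Antipodal m ⌊ n /2⌋)
  all-descents⇔antipodal = mk⇔
    (map₁ (double⇒even ⌊ n /2⌋) ∘ all-descents⇒antipodal-halves pm)
    (λ (2∣n , antipodal) → antipodal⇒all-descents pm (even⇒halves 2∣n) antipodal)
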